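{- Let $n\ge3$ and let $G_n$ be the $n$-gear, with maximum degree $\Delta$. Then $\chi_2(G_n)=4$, $\chi_3(G_n)=\chi_2(C_{2n})+1$, and $\chi_r(G_n)=\min\{r,\Delta\}+1$ for every admissible $r\ge4$.
   Context: The $n$-gear $G_n$ consists of a cycle $v_1v_2\cdots v_{2n}v_1$ on $2n$ vertices together with a center vertex $v_0$ adjacent to every $v_i$ with $i$ odd, $1\le i\le 2n-1$. $C_{2n}$ is the cycle on $2n$ vertices. All graphs are simple, connected and undirected; $N_G(v)$ is the open neighborhood, $d(v)=|N_G(v)|$, $\Delta$ the maximum degree. For a coloring $c$ and vertex set $S$, $c(S)=\{c(u):u\in S\}$. For integers $k>0$ and $0<r\le\Delta(G)$ with $r\le k$, a conditional $(k,r)$-coloring of $G$ is a surjective map $c:V(G)\to\{1,\dots,k\}$ such that (C1) $c(u)\ne c(v)$ whenever $uv\in E(G)$, and (C2) $|c(N_G(v))|\ge\min\{d(v),r\}$ for every vertex $v$. $\chi_r(G)$ is the smallest $k$ for which $G$ has a conditional $(k,r)$-coloring. -}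

module Defs where

open import Data.Nat using (ℕ; zero; suc; _+_; _*_; _≤_; _<_; _⊔_; _⊓_; _≡ᵇ_)
open import Data.Bool using (Bool; true; false; T; _∨_; _∧_; not)
open import Data.Fin using (Fin; toℕ)
open import Data.Fin.Properties using (_≟_)
open import Data.List using (List; length; map; filterᵇ; deduplicate; foldr; allFin)
open import Data.Product using (Σ; ∃; _×_)
open import Relation.Binary.PropositionalEquality using (_≡_; _≢_)

-- The concrete graphs below are built with 'simpleGraph',
-- which makes the relation symmetric and loop-free by construction.
record Graph : Set where
  field
    size : ℕ
    adj  : Fin size → Fin size → Bool
open Graph public

finEq : ∀ {m} → Fin m → Fin m → Bool
finEq i j = toℕ i ≡ᵇ toℕ j

simpleGraph : (m : ℕ) → (Fin m → Fin m → Bool) → Graph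
simpleGraph m raw = record
  { size = m
  ; adj  = λ u v → not (finEq u v) ∧ (raw u v ∨ raw v u) }

nbrs : (G : Graph) → Fin (size G) → List (Fin (size G))
nbrs G v = filterᵇ (adj G v) (allFin (size G))

deg : (G : Graph) → Fin (size G) → ℕ
deg G v = length (nbrs G v)

maxDeg : Graph → ℕ
maxDeg G = foldr _⊔_ 0 (map (deg G) (allFin (size G)))

numColours : ∀ {m k} → (Fin m → Fin k) → List (Fin m) → ℕ
numColours c S = length (deduplicate _≟_ (map c S))

record CondColouring (G : Graph) (k r : ℕ) : Set where
  field
    r≤k  : r ≤ k
    col  : Fin (size G) → Fin k
    surj : ∀ (i : Fin k) → ∃ λ v → col v ≡ i
    C1   : ∀ u v → T (adj G u v) → col u ≢ col v
    C2   : ∀ v → deg G v ⊓ r ≤ numColours col (nbrs G v)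

IsCondChrom : ℕ → Graph → ℕ → Set
IsCondChrom r G m = CondColouring G m r × (∀ k → CondColouring G k r → m ≤ k)

odd? : ℕ → Bool
odd? zero = false
odd? (suc zero) = true
odd? (suc (suc n)) = odd? n

cycAdjℕ : ℕ → ℕ → ℕ → Bool
cycAdjℕ L a b = (suc a ≡ᵇ b) ∨ (suc b ≡ᵇ a) ∨ ((a ≡ᵇ 1) ∧ (b ≡ᵇ L)) ∨ ((b ≡ᵇ 1) ∧ (a ≡ᵇ L))

-- Gear G_n: vertex 0 is the centre v₀, vertex i (1 ≤ i ≤ 2n) is v_i.
gearAdjℕ : ℕ → ℕ → ℕ → Bool
gearAdjℕ n zero zero = false
gearAdjℕ n zero (suc b) = odd? (suc b)
gearAdjℕ n (suc a) zero = odd? (suc a)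
gearAdjℕ n (suc a) (suc b) = cycAdjℕ (n + n) (suc a) (suc b)

-- Cycle C_L on vertices Fin L, vertex j standing for v_{j+1}.
cycleAdj : (L : ℕ) → Fin L → Fin L → Bool
cycleAdj L i j = cycAdjℕ L (suc (toℕ i)) (suc (toℕ j))

gear : ℕ → Graph
gear n = simpleGraph (suc (n + n)) (λ i j → gearAdjℕ n (toℕ i) (toℕ j))

cycle : ℕ → Graph
cycle L = simpleGraph L (cycleAdj L)

-- A conditional (k,2)-colouring of a cycle is exactly a proper colouring of its square: any
-- three consecutive vertices get distinct colours.  That needs three colours, and four unless 3
-- divides the length, since a three-colouring is then 3-periodic; periodic patterns attain both
-- bounds.  The rim of G_n is C_2n.  For r ≥ 3 each rim vertex has a rainbow neighbourhood, so
-- the rim is square coloured, and the centre's colour occurs nowhere on the rim: spokes are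
-- adjacent to the centre, and every other rim vertex shares a rainbow neighbourhood with it,
-- that of the preceding spoke.  Hence χ₃(G_n) = χ₂(C_2n) + 1, attained with a fresh centre
-- colour.  For r ≥ 4 the centre sees min(n, r) = r colours, so r + 1 are needed; they suffice
-- once spoke i is recoloured with a fresh colour i.  For r = 2 and three colours, both rim
-- neighbours of v_1 are non-spokes and must repeat the centre's colour, so v_1 sees one colour.

module Submission where

open import Defs
open import Data.Bool using (true; false; T; not; _∧_; _∨_)
open import Data.Bool.Properties using (T-∧; T-∨; ∨-idem)
open import Data.Empty using (⊥; ⊥-elim)
open import Data.Unit using (⊤; tt)
open import Data.Fin using (Fin; zero; suc; toℕ; fromℕ<)
import Data.Fin.Properties as Finₚ
open import Data.Fin.Properties using (toℕ-fromℕ<; toℕ-injective; toℕ<n) renaming (_≟_ to _≟ᶠ_)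
open import Data.List using (List; []; _∷_; length; map; allFin; deduplicate; foldr)
open import Data.List.Membership.Propositional using (_∈_; _∉_)
open import Data.List.Membership.Propositional.Properties
  using (∈-filter⁺; ∈-filter⁻; ∈-allFin; ∈-map⁺; ∈-map⁻; ∈-deduplicate⁺; ∈-deduplicate⁻)
open import Data.List.Properties using (length-map; length-tabulate; map-∘)
open import Data.List.Relation.Binary.Subset.Propositional using (_⊆_)
open import Data.List.Relation.Unary.All as All using (All; []; _∷_; all?)
open import Data.List.Relation.Unary.All.Properties using (¬Any⇒All¬)
open import Data.List.Relation.Unary.AllPairs using ([]; _∷_)
open import Data.List.Relation.Unary.Any using (here; there; _─_)
open import Data.List.Relation.Unary.Unique.Propositional using (Unique)
import Data.List.Relation.Unary.Unique.Propositional.Properties as Unique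
import Data.List.Relation.Unary.Unique.DecPropositional.Properties as DecUnique
open import Data.Nat
  using (ℕ; zero; suc; _+_; _*_; ⌊_/2⌋; _≤_; _<_; _⊓_; _⊔_; z≤n; s≤s; s≤s⁻¹; _≡ᵇ_; _≟_; _≤?_; _<?_)
open import Data.Nat.DivMod using (_mod_; m%n<n; m<n⇒m%n≡m)
open import Data.Nat.Properties
  using (≤-refl; ≤-reflexive; ≤-trans; <⇒≤; ≤∧≢⇒<; ≰⇒>; n≤1+n; m≤n+m; 1+n≢n; 1+n≰n; <-irrefl; +-mono-<;
         +-identityʳ; +-comm; +-suc; ⊓-glb; ⊔-lub; m⊓n≤n; m⊓n≤m; m≥n⇒m⊓n≡n; m≤n⇒m⊓n≡m;
         ≡ᵇ⇒≡; ≡⇒≡ᵇ; module ≤-Reasoning)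
open import Data.Nat.Tactic.RingSolver using (solve-∀)
open import Data.Product using (Σ; ∃; ∃-syntax; _×_; _,_; proj₂)
open import Data.Sum using (_⊎_; inj₁; inj₂)
open import Function using (_∘_)
open import Function.Bundles using (module Equivalence)
open import Relation.Binary.Construct.Closure.Symmetric using (SymClosure; fwd; bwd; symmetric)
open import Relation.Binary.PropositionalEquality
  using (_≡_; _≢_; refl; sym; trans; cong; subst; module ≡-Reasoning)
open import Relation.Nullary using (¬_; Dec; yes; no; ¬?)
open import Relation.Nullary.Decidable using (T?; map′; _×-dec_; from-yes)

open Equivalence using (to; from)

-- Counting distinct elements

module _ {A : Set} where

  ∈-─ : ∀ {x y} {ys : List A} (x∈ys : x ∈ ys) → y ∈ ys → y ≢ x → y ∈ (ys ─ x∈ys)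
  ∈-─ (here refl) (here refl)  y≢x = ⊥-elim (y≢x refl)
  ∈-─ (here refl) (there y∈ys) _   = y∈ys
  ∈-─ (there _)   (here refl)  _   = here refl
  ∈-─ (there x∈ys) (there y∈ys) y≢x = there (∈-─ x∈ys y∈ys y≢x)

  length-─ : ∀ {x} {ys : List A} (x∈ys : x ∈ ys) → length ys ≡ suc (length (ys ─ x∈ys))
  length-─ (here _)     = refl
  length-─ (there x∈ys) = cong suc (length-─ x∈ys)

  unique-⊆⇒length≤ : ∀ {xs ys : List A} → Unique xs → xs ⊆ ys → length xs ≤ length ys
  unique-⊆⇒length≤ {[]}     _              _     = z≤n
  unique-⊆⇒length≤ {x ∷ xs} {ys} (x∉xs ∷ xs!) xs⊆ys = begin
    suc (length xs)          ≤⟨ s≤s (unique-⊆⇒length≤ xs! xs⊆ys─x) ⟩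
    suc (length (ys ─ x∈ys)) ≡⟨ length-─ x∈ys ⟨
    length ys                ∎
    where
    open ≤-Reasoning
    x∈ys = xs⊆ys (here refl)
    xs⊆ys─x : xs ⊆ (ys ─ x∈ys)
    xs⊆ys─x y∈xs = ∈-─ x∈ys (xs⊆ys (there y∈xs)) (λ y≡x → All.lookup x∉xs y∈xs (sym y≡x))

unique⇒length≤ : ∀ {k} {xs : List (Fin k)} → Unique xs → length xs ≤ k
unique⇒length≤ {k} {xs} xs! =
  subst (length xs ≤_) (length-tabulate {n = k} (λ i → i)) (unique-⊆⇒length≤ xs! (λ {x} _ → ∈-allFin x))

-- Degrees and conditional colourings

module _ (G : Graph) where

  ∈-nbrs⁺ : ∀ {v u} → T (adj G v u) → u ∈ nbrs G v
  ∈-nbrs⁺ {v} {u} = ∈-filter⁺ (T? ∘ adj G v) (∈-allFin u)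

  ∈-nbrs⁻ : ∀ {v u} → u ∈ nbrs G v → T (adj G v u)
  ∈-nbrs⁻ {v} u∈ = proj₂ (∈-filter⁻ (T? ∘ adj G v) {xs = allFin (size G)} u∈)

  nbrs-unique : ∀ v → Unique (nbrs G v)
  nbrs-unique v = Unique.filter⁺ (T? ∘ adj G v) (Unique.allFin⁺ (size G))

  deg-≤ : ∀ {v us} → (∀ {u} → T (adj G v u) → u ∈ us) → deg G v ≤ length us
  deg-≤ {v} covers = unique-⊆⇒length≤ (nbrs-unique v) (covers ∘ ∈-nbrs⁻)

  deg-≥ : ∀ {v us} → Unique us → (∀ {u} → u ∈ us → T (adj G v u)) → length us ≤ deg G v
  deg-≥ us! adjacent = unique-⊆⇒length≤ us! (∈-nbrs⁺ ∘ adjacent)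

  maxDeg-≤ : ∀ {d} → (∀ v → deg G v ≤ d) → maxDeg G ≤ d
  maxDeg-≤ {d} bounded = go (allFin (size G))
    where
    go : ∀ vs → foldr _⊔_ 0 (map (deg G) vs) ≤ d
    go []       = z≤n
    go (v ∷ vs) = ⊔-lub (bounded v) (go vs)

module _ {m k} (c : Fin m → Fin k) where

  numColours-≤ : ∀ {S cs} → (∀ {u} → u ∈ S → c u ∈ cs) → numColours c S ≤ length cs
  numColours-≤ {S} coloured = unique-⊆⇒length≤ (DecUnique.deduplicate-! _≟ᶠ_ (map c S)) λ x∈ →
    let (u , u∈S , x≡cu) = ∈-map⁻ c (∈-deduplicate⁻ _≟ᶠ_ (map c S) x∈) in
    subst (_∈ _) (sym x≡cu) (coloured u∈S)

  numColours-≥ : ∀ {S us} → Unique (map c us) → us ⊆ S → length us ≤ numColours c S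
  numColours-≥ {S} {us} cus! us⊆S =
    subst (_≤ numColours c S) (length-map c us) (unique-⊆⇒length≤ cus! λ x∈ →
      let (u , u∈us , x≡cu) = ∈-map⁻ c x∈ in
      subst (_∈ _) (sym x≡cu) (∈-deduplicate⁺ _≟ᶠ_ (∈-map⁺ c (us⊆S u∈us))))

module _ {G k r} (χ : CondColouring G k r) where
  open CondColouring χ

  closedNeighbourhood-bound : ∀ v → suc (deg G v ⊓ r) ≤ k
  closedNeighbourhood-bound v = begin
    suc (deg G v ⊓ r)               ≤⟨ s≤s (C2 v) ⟩
    suc (numColours col (nbrs G v)) ≤⟨ unique⇒length≤ (fresh ∷ DecUnique.deduplicate-! _≟ᶠ_ _) ⟩
    k                               ∎
    where
    open ≤-Reasoning
    fresh : All (col v ≢_) (deduplicate _≟ᶠ_ (map col (nbrs G v)))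
    fresh = All.tabulate λ x∈ →
      let (u , u∈ , x≡cu) = ∈-map⁻ col (∈-deduplicate⁻ _≟ᶠ_ (map col (nbrs G v)) x∈) in
      subst (col v ≢_) (sym x≡cu) (C1 v u (∈-nbrs⁻ G u∈))

  rainbow-neighbourhood :
    ∀ {v S} → Unique S → (∀ {u} → u ∈ S → T (adj G v u)) → (∀ {u} → T (adj G v u) → u ∈ S) →
    length S ≤ r → ∀ {u w} → u ∈ S → w ∈ S → u ≢ w → col u ≢ col w
  rainbow-neighbourhood {v} {S} S! adjacent covers S≤r {u} {w} u∈S w∈S u≢w cu≡cw = 1+n≰n (begin
    suc (length (S ─ w∈S))             ≡⟨ length-─ w∈S ⟨
    length S                           ≤⟨ ⊓-glb (deg-≥ G S! adjacent) S≤r ⟩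
    deg G v ⊓ r                        ≤⟨ C2 v ⟩
    numColours col (nbrs G v)          ≤⟨ numColours-≤ col coloured ⟩
    length (map col (S ─ w∈S))         ≡⟨ length-map col (S ─ w∈S) ⟩
    length (S ─ w∈S)                   ∎)
    where
    open ≤-Reasoning
    coloured : ∀ {x} → x ∈ nbrs G v → col x ∈ map col (S ─ w∈S)
    coloured {x} x∈ with x ≟ᶠ w
    ... | yes refl = subst (_∈ map col (S ─ w∈S)) cu≡cw (∈-map⁺ col (∈-─ w∈S u∈S u≢w))
    ... | no x≢w   = ∈-map⁺ col (∈-─ w∈S (covers (∈-nbrs⁻ G x∈)) x≢w)

-- Positions on a cycle and square colourings

-- Positions 0, …, ℓ of a cycle of length ℓ + 1; a 'step p' is an edge only when p < ℓ.
data CycStep (ℓ : ℕ) : ℕ → ℕ → Set where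
  step : ∀ p → CycStep ℓ p (suc p)
  wrap : CycStep ℓ ℓ zero

CycAdj : ℕ → ℕ → ℕ → Set
CycAdj ℓ = SymClosure (CycStep ℓ)

prev : ℕ → ℕ → ℕ
prev ℓ zero    = ℓ
prev ℓ (suc p) = p

next : ℕ → ℕ → ℕ
next ℓ p with p ≟ ℓ
... | yes _ = zero
... | no  _ = suc p

≡ᵇ-refl : ∀ n → (n ≡ᵇ n) ≡ true
≡ᵇ-refl zero    = refl
≡ᵇ-refl (suc n) = ≡ᵇ-refl n

≢⇒T-not-≡ᵇ : ∀ m n → m ≢ n → T (not (m ≡ᵇ n))
≢⇒T-not-≡ᵇ zero    zero    m≢n = m≢n refl
≢⇒T-not-≡ᵇ zero    (suc n) _   = _
≢⇒T-not-≡ᵇ (suc m) zero    _   = _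
≢⇒T-not-≡ᵇ (suc m) (suc n) m≢n = ≢⇒T-not-≡ᵇ m n (m≢n ∘ cong suc)

T-∨ʳ : ∀ a {b} → T b → T (a ∨ b)
T-∨ʳ true  _ = _
T-∨ʳ false t = t

T-∨-true : ∀ a → T (a ∨ true)
T-∨-true a = T-∨ʳ a _

module _ {ℓ : ℕ} where

  next-ℓ : next ℓ ℓ ≡ zero
  next-ℓ with ℓ ≟ ℓ
  ... | yes _   = refl
  ... | no ℓ≢ℓ = ⊥-elim (ℓ≢ℓ refl)

  next-< : ∀ {p} → p < ℓ → next ℓ p ≡ suc p
  next-< {p} p<ℓ with p ≟ ℓ
  ... | yes refl = ⊥-elim (<-irrefl refl p<ℓ)
  ... | no _     = refl

  prev-≤ : ∀ {p} → p ≤ ℓ → prev ℓ p ≤ ℓ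
  prev-≤ {zero}  _   = ≤-refl
  prev-≤ {suc p} p<ℓ = <⇒≤ p<ℓ

  next-≤ : ∀ {p} → p ≤ ℓ → next ℓ p ≤ ℓ
  next-≤ {p} p≤ℓ with p ≟ ℓ
  ... | yes _   = z≤n
  ... | no p≢ℓ = ≤∧≢⇒< p≤ℓ p≢ℓ

  prev-adj : ∀ p → CycAdj ℓ p (prev ℓ p)
  prev-adj zero    = bwd wrap
  prev-adj (suc p) = bwd (step p)

  next-adj : ∀ p → CycAdj ℓ p (next ℓ p)
  next-adj p with p ≟ ℓ
  ... | yes refl = fwd wrap
  ... | no _     = fwd (step p)

  prev≢next : ∀ {p} → 2 ≤ ℓ → p ≤ ℓ → prev ℓ p ≢ next ℓ p
  prev≢next {zero} 2≤ℓ _ ℓ≡next rewrite next-< (≤-trans (s≤s z≤n) 2≤ℓ) =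
    1+n≰n (subst (2 ≤_) ℓ≡next 2≤ℓ)
  prev≢next {suc p} 2≤ℓ _ with suc p ≟ ℓ
  ... | yes refl = λ { refl → 1+n≰n 2≤ℓ }
  ... | no _     = λ p≡p+2 → <-irrefl p≡p+2 (s≤s (n≤1+n p))

  adj⇒prev⊎next : ∀ {p q} → q ≤ ℓ → CycAdj ℓ p q → q ≡ prev ℓ p ⊎ q ≡ next ℓ p
  adj⇒prev⊎next p<ℓ (fwd (step p))  = inj₂ (sym (next-< p<ℓ))
  adj⇒prev⊎next _   (fwd wrap)      = inj₂ (sym next-ℓ)
  adj⇒prev⊎next _   (bwd (step q))  = inj₁ refl
  adj⇒prev⊎next _   (bwd wrap)      = inj₁ refl

  adj⇒≢ : ∀ {p q} → 1 ≤ ℓ → CycAdj ℓ p q → p ≢ q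
  adj⇒≢ _   (fwd (step p)) = 1+n≢n ∘ sym
  adj⇒≢ 1≤ℓ (fwd wrap)     = λ { refl → 1+n≰n 1≤ℓ }
  adj⇒≢ _   (bwd (step q)) = 1+n≢n
  adj⇒≢ 1≤ℓ (bwd wrap)     = λ { refl → 1+n≰n 1≤ℓ }

  cycAdjℕ⇒CycAdj : ∀ p q → T (cycAdjℕ (suc ℓ) (suc p) (suc q)) → CycAdj ℓ p q
  cycAdjℕ⇒CycAdj p q t with to T-∨ t
  ... | inj₁ p+1≡q = fwd (subst (CycStep ℓ p) (≡ᵇ⇒≡ (suc p) q p+1≡q) (step p))
  ... | inj₂ t₁ with to T-∨ t₁
  ...   | inj₁ q+1≡p = bwd (subst (CycStep ℓ q) (≡ᵇ⇒≡ (suc q) p q+1≡p) (step q))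
  ...   | inj₂ t₂ with to T-∨ t₂
  ...     | inj₁ t₃ = bwd (wrap′ (to T-∧ t₃))
    where
    wrap′ : T (p ≡ᵇ 0) × T (q ≡ᵇ ℓ) → CycStep ℓ q p
    wrap′ (p≡0 , q≡ℓ) with ≡ᵇ⇒≡ p 0 p≡0 | ≡ᵇ⇒≡ q ℓ q≡ℓ
    ... | refl | refl = wrap
  ...     | inj₂ t₃ = fwd (wrap′ (to T-∧ t₃))
    where
    wrap′ : T (q ≡ᵇ 0) × T (p ≡ᵇ ℓ) → CycStep ℓ p q
    wrap′ (q≡0 , p≡ℓ) with ≡ᵇ⇒≡ q 0 q≡0 | ≡ᵇ⇒≡ p ℓ p≡ℓ
    ... | refl | refl = wrap

  CycAdj⇒cycAdjℕ : ∀ {p q} → CycAdj ℓ p q → T (cycAdjℕ (suc ℓ) (suc p) (suc q))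
  CycAdj⇒cycAdjℕ (fwd (step p)) rewrite ≡ᵇ-refl p = _
  CycAdj⇒cycAdjℕ (bwd (step q)) rewrite ≡ᵇ-refl q = T-∨-true (suc (suc q) ≡ᵇ q)
  CycAdj⇒cycAdjℕ (bwd wrap)     rewrite ≡ᵇ-refl ℓ = T-∨-true (1 ≡ᵇ ℓ)
  CycAdj⇒cycAdjℕ (fwd wrap)     rewrite ≡ᵇ-refl ℓ =
    T-∨ʳ (1 ≡ᵇ ℓ) (T-∨-true ((ℓ ≡ᵇ 0) ∧ (0 ≡ᵇ ℓ)))

record Distinct₃ {A : Set} (a b c : A) : Set where
  constructor distinct₃
  field
    a≢b : a ≢ b
    a≢c : a ≢ c
    b≢c : b ≢ c
open Distinct₃

-- A proper colouring of the square of the cycle on positions 0, …, ℓ.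
SquareColouring : {A : Set} → ℕ → (ℕ → A) → Set
SquareColouring ℓ F = ∀ {p} → p ≤ ℓ → Distinct₃ (F (prev ℓ p)) (F p) (F (next ℓ p))

module _ {A : Set} {ℓ} {F : ℕ → A} (F-sq : SquareColouring ℓ F) where

  square-consecutive : ∀ {p} → suc (suc p) ≤ ℓ → Distinct₃ (F p) (F (suc p)) (F (suc (suc p)))
  square-consecutive {p} p+2≤ℓ =
    subst (λ q → Distinct₃ (F p) (F (suc p)) (F q)) (next-< p+2≤ℓ) (F-sq (<⇒≤ p+2≤ℓ))

module _ {k ℓ} {F : ℕ → Fin k} (F-sq : SquareColouring ℓ F) where

  square-≥3 : ∀ {xs} → 2 ≤ ℓ → Unique xs → (∀ {p} → p ≤ ℓ → F p ∉ xs) → 3 + length xs ≤ k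
  square-≥3 {xs} 2≤ℓ xs! avoids = unique⇒length≤
    ((a≢b F₀₁₂ ∷ a≢c F₀₁₂ ∷ ¬Any⇒All¬ xs (avoids z≤n)) ∷
     (b≢c F₀₁₂ ∷ ¬Any⇒All¬ xs (avoids (≤-trans (n≤1+n 1) 2≤ℓ))) ∷
     ¬Any⇒All¬ xs (avoids 2≤ℓ) ∷ xs!)
    where F₀₁₂ = square-consecutive F-sq 2≤ℓ

  square-periodic : ∀ {cs} → length cs ≤ 3 → (∀ {p} → p ≤ ℓ → F p ∈ cs) →
                    ∀ j {i} → j * 3 + i ≤ ℓ → F (j * 3 + i) ≡ F i
  square-periodic _      _      zero    _  = refl
  square-periodic {cs} cs≤3 coloured (suc j) {i} le =
    trans (period (j * 3 + i) le) (square-periodic cs≤3 coloured j (≤-trans (m≤n+m _ 3) le))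
    where
    period : ∀ p → 3 + p ≤ ℓ → F (3 + p) ≡ F p
    period p p+3≤ℓ with F (3 + p) ≟ᶠ F p
    ... | yes e    = e
    ... | no  F₃≢F₀ = ⊥-elim (1+n≰n (≤-trans (unique-⊆⇒length≤ four-distinct in-cs) cs≤3))
      where
      T₀ = square-consecutive F-sq (≤-trans (n≤1+n _) p+3≤ℓ)
      T₁ = square-consecutive F-sq p+3≤ℓ
      four-distinct : Unique (F p ∷ F (1 + p) ∷ F (2 + p) ∷ F (3 + p) ∷ [])
      four-distinct =
        (a≢b T₀ ∷ a≢c T₀ ∷ F₃≢F₀ ∘ sym ∷ []) ∷ (b≢c T₀ ∷ a≢c T₁ ∷ []) ∷ (b≢c T₁ ∷ []) ∷ [] ∷ []
      in-cs : (F p ∷ F (1 + p) ∷ F (2 + p) ∷ F (3 + p) ∷ []) ⊆ cs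
      in-cs (here refl)                      = coloured (≤-trans (m≤n+m p 3) p+3≤ℓ)
      in-cs (there (here refl))              = coloured (≤-trans (m≤n+m _ 2) p+3≤ℓ)
      in-cs (there (there (here refl)))      = coloured (≤-trans (n≤1+n _) p+3≤ℓ)
      in-cs (there (there (there (here refl)))) = coloured p+3≤ℓ

  -- The disjunction says that 3 does not divide the length ℓ + 1.
  square-≥4 : ∀ {xs} j → ℓ ≡ j * 3 ⊎ ℓ ≡ suc (j * 3) → 2 ≤ ℓ → Unique xs →
              (∀ {p} → p ≤ ℓ → F p ∉ xs) → 4 + length xs ≤ k
  square-≥4 {xs} j ℓ≡ 2≤ℓ xs! avoids with 4 + length xs ≤? k
  ... | yes fits = fits
  ... | no  k≤3+xs = ⊥-elim (wraps ℓ≡)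
    where
    F₀₁₂ = square-consecutive F-sq 2≤ℓ
    1≤ℓ = ≤-trans (n≤1+n 1) 2≤ℓ
    three : ∀ {p} → p ≤ ℓ → F p ∈ (F 0 ∷ F 1 ∷ F 2 ∷ [])
    three {p} p≤ℓ with F p ≟ᶠ F 0 | F p ≟ᶠ F 1 | F p ≟ᶠ F 2
    ... | yes e | _     | _     = here e
    ... | no _  | yes e | _     = there (here e)
    ... | no _  | no _  | yes e = there (there (here e))
    ... | no F₀ | no F₁ | no F₂ = ⊥-elim (k≤3+xs (unique⇒length≤
      ((F₀ ∷ F₁ ∷ F₂ ∷ avoid p≤ℓ) ∷ (a≢b F₀₁₂ ∷ a≢c F₀₁₂ ∷ avoid z≤n) ∷
       (b≢c F₀₁₂ ∷ avoid 1≤ℓ) ∷ avoid 2≤ℓ ∷ xs!)))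
      where
      avoid : ∀ {q} → q ≤ ℓ → All (F q ≢_) xs
      avoid q≤ℓ = ¬Any⇒All¬ xs (avoids q≤ℓ)
    periodic = square-periodic ≤-refl three
    wraps : ℓ ≡ j * 3 ⊎ ℓ ≡ suc (j * 3) → ⊥
    wraps (inj₁ refl) = a≢b (F-sq z≤n) (begin
      F (j * 3)       ≡⟨ cong F (+-identityʳ (j * 3)) ⟨
      F (j * 3 + 0)   ≡⟨ periodic j (≤-reflexive (+-identityʳ (j * 3))) ⟩
      F 0             ∎)
      where open ≡-Reasoning
    wraps (inj₂ refl) = a≢c (F-sq z≤n) (begin
      F (suc (j * 3)) ≡⟨ cong F (+-comm 1 (j * 3)) ⟩
      F (j * 3 + 1)   ≡⟨ periodic j (≤-reflexive (+-comm (j * 3) 1)) ⟩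
      F 1             ≡⟨ cong F (next-< 1≤ℓ) ⟨
      F (next ℓ 0)    ∎)
      where open ≡-Reasoning

-- The cycle C_{ℓ+1}

module _ {k} {f : ℕ → ℕ} (f< : ∀ p → f p < k) where

  colourFin : ℕ → Fin k
  colourFin p = fromℕ< (f< p)

  toℕ-colourFin : ∀ p → toℕ (colourFin p) ≡ f p
  toℕ-colourFin p = toℕ-fromℕ< (f< p)

  colourFin-≢ : ∀ {p q} → f p ≢ f q → colourFin p ≢ colourFin q
  colourFin-≢ {p} {q} fp≢fq e = fp≢fq (trans (sym (toℕ-colourFin p)) (trans (cong toℕ e) (toℕ-colourFin q)))

module Cycle {ℓ : ℕ} (2≤ℓ : 2 ≤ ℓ) where

  C : Graph
  C = cycle (suc ℓ)

  vertexAt : ℕ → Fin (suc ℓ)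
  vertexAt p = p mod suc ℓ

  toℕ-vertexAt : ∀ {p} → p ≤ ℓ → toℕ (vertexAt p) ≡ p
  toℕ-vertexAt {p} p≤ℓ = trans (toℕ-fromℕ< (m%n<n p (suc ℓ))) (m<n⇒m%n≡m (s≤s p≤ℓ))

  vertexAt-toℕ : ∀ i → vertexAt (toℕ i) ≡ i
  vertexAt-toℕ i = toℕ-injective (toℕ-vertexAt (s≤s⁻¹ (toℕ<n i)))

  prevV nextV : Fin (suc ℓ) → Fin (suc ℓ)
  prevV i = vertexAt (prev ℓ (toℕ i))
  nextV i = vertexAt (next ℓ (toℕ i))

  toℕ-prevV : ∀ i → toℕ (prevV i) ≡ prev ℓ (toℕ i)
  toℕ-prevV i = toℕ-vertexAt (prev-≤ (s≤s⁻¹ (toℕ<n i)))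

  toℕ-nextV : ∀ i → toℕ (nextV i) ≡ next ℓ (toℕ i)
  toℕ-nextV i = toℕ-vertexAt (next-≤ (s≤s⁻¹ (toℕ<n i)))

  adj⁻ : ∀ {i j} → T (adj C i j) → CycAdj ℓ (toℕ i) (toℕ j)
  adj⁻ {i} {j} t with to T-∨ (proj₂ (to T-∧ t))
  ... | inj₁ i~j = cycAdjℕ⇒CycAdj (toℕ i) (toℕ j) i~j
  ... | inj₂ j~i = symmetric _ (cycAdjℕ⇒CycAdj (toℕ j) (toℕ i) j~i)

  adj⁺ : ∀ {i j} → CycAdj ℓ (toℕ i) (toℕ j) → T (adj C i j)
  adj⁺ {i} {j} i~j = from T-∧ (≢⇒T-not-≡ᵇ (toℕ i) (toℕ j) (adj⇒≢ (≤-trans (n≤1+n 1) 2≤ℓ) i~j) ,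
                               from T-∨ (inj₁ (CycAdj⇒cycAdjℕ i~j)))

  adj-prevV : ∀ i → T (adj C i (prevV i))
  adj-prevV i = adj⁺ (subst (CycAdj ℓ (toℕ i)) (sym (toℕ-prevV i)) (prev-adj (toℕ i)))

  adj-nextV : ∀ i → T (adj C i (nextV i))
  adj-nextV i = adj⁺ (subst (CycAdj ℓ (toℕ i)) (sym (toℕ-nextV i)) (next-adj (toℕ i)))

  prevV≢nextV : ∀ i → prevV i ≢ nextV i
  prevV≢nextV i e = prev≢next 2≤ℓ (s≤s⁻¹ (toℕ<n i))
    (trans (sym (toℕ-prevV i)) (trans (cong toℕ e) (toℕ-nextV i)))

  adj⇒prevV⊎nextV : ∀ {i j} → T (adj C i j) → j ≡ prevV i ⊎ j ≡ nextV i
  adj⇒prevV⊎nextV {i} {j} t with adj⇒prev⊎next (s≤s⁻¹ (toℕ<n j)) (adj⁻ t)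
  ... | inj₁ e = inj₁ (trans (sym (vertexAt-toℕ j)) (cong vertexAt e))
  ... | inj₂ e = inj₂ (trans (sym (vertexAt-toℕ j)) (cong vertexAt e))

  square-at : ∀ {A : Set} {f : ℕ → A} → SquareColouring ℓ f →
              ∀ i → Distinct₃ (f (toℕ (prevV i))) (f (toℕ i)) (f (toℕ (nextV i)))
  square-at {f = f} f-sq i rewrite toℕ-prevV i | toℕ-nextV i = f-sq (s≤s⁻¹ (toℕ<n i))

  square-of-vertices : ∀ {A : Set} {c : Fin (suc ℓ) → A} →
    (∀ i → Distinct₃ (c (prevV i)) (c i) (c (nextV i))) → SquareColouring ℓ (c ∘ vertexAt)
  square-of-vertices {c = c} c-sq {p} p≤ℓ with c-sq (vertexAt p)
  ... | triple rewrite toℕ-vertexAt p≤ℓ = triple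

  neighbours : Fin (suc ℓ) → List (Fin (suc ℓ))
  neighbours i = prevV i ∷ nextV i ∷ []

  neighbours! : ∀ i → Unique (neighbours i)
  neighbours! i = (prevV≢nextV i ∷ []) ∷ [] ∷ []

  neighbours-cover : ∀ {i u} → T (adj C i u) → u ∈ neighbours i
  neighbours-cover {i} {u} t with adj⇒prevV⊎nextV {i} {u} t
  ... | inj₁ refl = here refl
  ... | inj₂ refl = there (here refl)

  neighbours-adj : ∀ {i u} → u ∈ neighbours i → T (adj C i u)
  neighbours-adj {i} (here refl)         = adj-prevV i
  neighbours-adj {i} (there (here refl)) = adj-nextV i

  cycle-colouring : ∀ {k} {f : ℕ → ℕ} → SquareColouring ℓ f → (f< : ∀ p → f p < k) →
                    (∀ c → c < k → ∃[ p ] p ≤ ℓ × f p ≡ c) → 2 ≤ k → CondColouring C k 2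
  cycle-colouring {k} {f} f-sq f< onto 2≤k =
    record { r≤k = 2≤k ; col = col ; surj = surj ; C1 = C1 ; C2 = C2 }
    where
    col : Fin (suc ℓ) → Fin k
    col = colourFin f< ∘ toℕ
    surj : ∀ c → ∃ λ i → col i ≡ c
    surj c with onto (toℕ c) (toℕ<n c)
    ... | p , p≤ℓ , fp≡c = vertexAt p ,
      toℕ-injective (trans (toℕ-colourFin f< _) (trans (cong f (toℕ-vertexAt p≤ℓ)) fp≡c))
    C1 : ∀ i j → T (adj C i j) → col i ≢ col j
    C1 i j t with adj⇒prevV⊎nextV {i} {j} t
    ... | inj₁ refl = colourFin-≢ f< (a≢b (square-at f-sq i) ∘ sym)
    ... | inj₂ refl = colourFin-≢ f< (b≢c (square-at f-sq i))
    C2 : ∀ i → deg C i ⊓ 2 ≤ numColours col (nbrs C i)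
    C2 i = ≤-trans (m⊓n≤n _ 2) (numColours-≥ col {S = nbrs C i} {us = neighbours i}
      ((colourFin-≢ f< (a≢c (square-at f-sq i)) ∷ []) ∷ [] ∷ []) (∈-nbrs⁺ C {v = i} ∘ neighbours-adj))

  cycle-square : ∀ {k} (χ : CondColouring C k 2) → SquareColouring ℓ (CondColouring.col χ ∘ vertexAt)
  cycle-square χ = square-of-vertices λ i → distinct₃
    (C1 i (prevV i) (adj-prevV i) ∘ sym)
    (rainbow-neighbourhood χ {v = i} (neighbours! i) neighbours-adj neighbours-cover ≤-refl
       (here refl) (there (here refl)) (prevV≢nextV i))
    (C1 i (nextV i) (adj-nextV i))
    where open CondColouring χ

-- Spokes and recolouring

-- Rim position p is the vertex v_{p+1} of the gear, so the spokes sit at the even positions.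
Spoke : ℕ → Set
Spoke p = T (odd? (suc p))

odd?-suc : ∀ p → odd? (suc p) ≡ not (odd? p)
odd?-suc zero          = refl
odd?-suc (suc zero)    = refl
odd?-suc (suc (suc p)) = odd?-suc p

odd?-double : ∀ i → odd? (i + i) ≡ false
odd?-double zero    = refl
odd?-double (suc i) rewrite +-suc i i = odd?-double i

spoke-double : ∀ i → Spoke (i + i)
spoke-double i rewrite odd?-suc (i + i) | odd?-double i = _

¬spoke⇒spoke-suc : ∀ {p} → ¬ Spoke p → Spoke (suc p)
¬spoke⇒spoke-suc {p} ¬s rewrite odd?-suc p with odd? p
... | true  = _
... | false = ¬s _

¬spoke-suc⇒spoke : ∀ {p} → ¬ Spoke (suc p) → Spoke p
¬spoke-suc⇒spoke {p} ¬s rewrite odd?-suc p with odd? p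
... | true  = ⊥-elim (¬s _)
... | false = _

half-double : ∀ i → ⌊ i + i /2⌋ ≡ i
half-double zero    = refl
half-double (suc i) rewrite +-suc i i = cong suc (half-double i)

spoke⇒double : ∀ {p} → Spoke p → ⌊ p /2⌋ + ⌊ p /2⌋ ≡ p
spoke⇒double {zero}        _ = refl
spoke⇒double {suc (suc p)} s =
  trans (+-suc (suc ⌊ p /2⌋) ⌊ p /2⌋) (cong (λ m → suc (suc m)) (spoke⇒double {p} s))

¬spoke⇒prev-spoke : ∀ {ℓ p} → ¬ Spoke p → Spoke (prev ℓ p)
¬spoke⇒prev-spoke {p = zero}  ¬s = ⊥-elim (¬s _)
¬spoke⇒prev-spoke {p = suc p} ¬s = ¬spoke-suc⇒spoke {p} ¬s

¬spoke⇒next-spoke : ∀ {ℓ p} → ¬ Spoke p → Spoke (next ℓ p)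
¬spoke⇒next-spoke {ℓ} {p} ¬s with p ≟ ℓ
... | yes _ = _
... | no _  = ¬spoke⇒spoke-suc {p} ¬s

Fresh : ℕ → ℕ → ℕ → Set
Fresh m r p = Spoke p × m ≤ ⌊ p /2⌋ × ⌊ p /2⌋ < r

fresh? : ∀ m r p → Dec (Fresh m r p)
fresh? m r p = T? (odd? (suc p)) ×-dec m ≤? ⌊ p /2⌋ ×-dec ⌊ p /2⌋ <? r

-- Spoke i sits at position 2i; it gets the new colour i when m ≤ i < r.
recolour : ℕ → ℕ → (ℕ → ℕ) → ℕ → ℕ
recolour m r h p with fresh? m r p
... | yes _ = ⌊ p /2⌋
... | no  _ = h p

module _ {m r} {h : ℕ → ℕ} (h<m : ∀ p → h p < m) (m≤r : m ≤ r) where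

  recolour-< : ∀ p → recolour m r h p < r
  recolour-< p with fresh? m r p
  ... | yes (_ , _ , half<r) = half<r
  ... | no  _                = ≤-trans (h<m p) m≤r

  recolour-≢ : ∀ {p q} → p ≢ q → h p ≢ h q → recolour m r h p ≢ recolour m r h q
  recolour-≢ {p} {q} p≢q hp≢hq with fresh? m r p | fresh? m r q
  ... | yes (sp , _ , _) | yes (sq , _ , _) = λ e →
    p≢q (trans (sym (spoke⇒double sp)) (trans (cong (λ i → i + i) e) (spoke⇒double sq)))
  ... | yes (_ , m≤p , _) | no _ = λ e → <-irrefl refl (≤-trans (subst (_< m) (sym e) (h<m q)) m≤p)
  ... | no _ | yes (_ , m≤q , _) = λ e → <-irrefl refl (≤-trans (subst (_< m) e (h<m p)) m≤q)
  ... | no _ | no _ = hp≢hq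

  recolour-spokes : (∀ {i} → i < m → h (i + i) ≡ i) → ∀ {i} → i < r → recolour m r h (i + i) ≡ i
  recolour-spokes h-spokes {i} i<r with fresh? m r (i + i)
  ... | yes _ = half-double i
  ... | no ¬fresh with m ≤? i
  ...   | yes m≤i = ⊥-elim (¬fresh (spoke-double i , subst (m ≤_) half≡ m≤i , subst (_< r) half≡ i<r))
    where half≡ = sym (half-double i)
  ...   | no  m≰i = h-spokes (≰⇒> m≰i)

  recolour-square : ∀ {ℓ} → 2 ≤ ℓ → SquareColouring ℓ h → SquareColouring ℓ (recolour m r h)
  recolour-square 2≤ℓ h-sq {p} p≤ℓ = distinct₃
    (recolour-≢ (adj⇒≢ 1≤ℓ (prev-adj p) ∘ sym) (a≢b (h-sq p≤ℓ)))
    (recolour-≢ (prev≢next 2≤ℓ p≤ℓ) (a≢c (h-sq p≤ℓ)))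
    (recolour-≢ (adj⇒≢ 1≤ℓ (next-adj p)) (b≢c (h-sq p≤ℓ)))
    where 1≤ℓ = ≤-trans (n≤1+n 1) 2≤ℓ

double-<⇒< : ∀ {h m} → h + h < m + m → h < m
double-<⇒< {zero}  {suc m} _  = s≤s z≤n
double-<⇒< {suc h} {suc m} lt rewrite +-suc h h | +-suc m m = s≤s (double-<⇒< (s≤s⁻¹ (s≤s⁻¹ lt)))

-- The gear G_n for n = 3 + n′.  Since adj (gear n) (suc i) (suc j) reduces to
-- adj (cycle (n + n)) i j, the rim of G_n is literally the cycle C_2n.
module Gear (n′ : ℕ) where

  n ℓ : ℕ
  n = 3 + n′
  ℓ = suc (suc (n′ + n))

  open Cycle {ℓ} (s≤s (s≤s z≤n)) public

  G : Graph
  G = gear n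

  centre : Fin (size G)
  centre = zero

  rim : ℕ → Fin (size G)
  rim p = suc (vertexAt p)

  -- Between the centre and suc i, adj G reduces to b ∨ b with b = odd? (suc (toℕ i)).
  spoke⇒adj : ∀ {i} → Spoke (toℕ i) → T (adj G centre (suc i))
  spoke⇒adj {i} = subst T (sym (∨-idem (odd? (suc (toℕ i)))))

  spoke⇒adj˘ : ∀ {i} → Spoke (toℕ i) → T (adj G (suc i) centre)
  spoke⇒adj˘ {i} = subst T (sym (∨-idem (odd? (suc (toℕ i)))))

  adj⇒spoke : ∀ {i} → T (adj G centre (suc i)) → Spoke (toℕ i)
  adj⇒spoke {i} = subst T (∨-idem (odd? (suc (toℕ i))))

  adj˘⇒spoke : ∀ {i} → T (adj G (suc i) centre) → Spoke (toℕ i)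
  adj˘⇒spoke {i} = subst T (∨-idem (odd? (suc (toℕ i))))

  ¬spoke-ℓ : ¬ Spoke ℓ
  ¬spoke-ℓ rewrite odd?-double n = λ ()

  double≤ℓ : ∀ {i} → i < n → i + i ≤ ℓ
  double≤ℓ i<n = s≤s⁻¹ (+-mono-< i<n i<n)

  spokeAt : ℕ → Fin (size G)
  spokeAt i = rim (i + i)

  toℕ-spokeAt : ∀ {i} → i < n → toℕ (vertexAt (i + i)) ≡ i + i
  toℕ-spokeAt i<n = toℕ-vertexAt (double≤ℓ i<n)

  adj-spokeAt : ∀ {i} → i < n → T (adj G centre (spokeAt i))
  adj-spokeAt {i} i<n = spoke⇒adj {vertexAt (i + i)} (subst Spoke (sym (toℕ-spokeAt i<n)) (spoke-double i))

  spokes : ℕ → List (Fin (size G))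
  spokes m = map (spokeAt ∘ toℕ) (allFin m)

  length-spokes : ∀ m → length (spokes m) ≡ m
  length-spokes m = trans (length-map (spokeAt ∘ toℕ) (allFin m)) (length-tabulate {n = m} (λ i → i))

  spokes-adj : ∀ {m u} → m ≤ n → u ∈ spokes m → T (adj G centre u)
  spokes-adj {m} m≤n u∈ with ∈-map⁻ (spokeAt ∘ toℕ) u∈
  ... | i , _ , refl = adj-spokeAt (≤-trans (toℕ<n i) m≤n)

  spokes! : ∀ {m} → m ≤ n → Unique (spokes m)
  spokes! m≤n = Unique.map⁺ spokeAt-injective (Unique.allFin⁺ _)
    where
    spokeAt-injective : ∀ {a b} → spokeAt (toℕ a) ≡ spokeAt (toℕ b) → a ≡ b
    spokeAt-injective {a} {b} e = toℕ-injective (begin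
      toℕ a                                ≡⟨ half-double (toℕ a) ⟨
      ⌊ toℕ a + toℕ a /2⌋                  ≡⟨ cong ⌊_/2⌋ (toℕ-spokeAt (≤-trans (toℕ<n a) m≤n)) ⟨
      ⌊ toℕ (vertexAt (toℕ a + toℕ a)) /2⌋ ≡⟨ cong (λ v → ⌊ toℕ v /2⌋) (Finₚ.suc-injective e) ⟩
      ⌊ toℕ (vertexAt (toℕ b + toℕ b)) /2⌋ ≡⟨ cong ⌊_/2⌋ (toℕ-spokeAt (≤-trans (toℕ<n b) m≤n)) ⟩
      ⌊ toℕ b + toℕ b /2⌋                  ≡⟨ half-double (toℕ b) ⟩
      toℕ b                                ∎)
      where open ≡-Reasoning

  centre-deg-≥ : n ≤ deg G centre
  centre-deg-≥ =
    subst (_≤ deg G centre) (length-spokes n) (deg-≥ G {centre} (spokes! ≤-refl) (spokes-adj ≤-refl))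

  centre-deg-≤ : deg G centre ≤ n
  centre-deg-≤ = subst (deg G centre ≤_) (length-spokes n) (deg-≤ G {centre} covers)
    where
    covers : ∀ {u} → T (adj G centre u) → u ∈ spokes n
    covers {suc j} t = subst (_∈ spokes n) j-spoke (∈-map⁺ (spokeAt ∘ toℕ) (∈-allFin (fromℕ< h<n)))
      where
      h = ⌊ toℕ j /2⌋
      h+h≡j = spoke⇒double (adj⇒spoke {j} t)
      h<n : h < n
      h<n = double-<⇒< (subst (_< n + n) (sym h+h≡j) (toℕ<n j))
      j-spoke : spokeAt (toℕ (fromℕ< h<n)) ≡ suc j
      j-spoke = cong suc (trans (cong (λ m → vertexAt (m + m)) (toℕ-fromℕ< h<n))
                  (trans (cong vertexAt h+h≡j) (vertexAt-toℕ j)))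

  rim-neighbours : ∀ i → List (Fin (size G))
  rim-neighbours i = suc (prevV i) ∷ suc (nextV i) ∷ []

  rim-neighbours! : ∀ i → Unique (rim-neighbours i)
  rim-neighbours! i = ((prevV≢nextV i ∘ Finₚ.suc-injective) ∷ []) ∷ [] ∷ []

  rim-neighbours-adj : ∀ {i u} → u ∈ rim-neighbours i → T (adj G (suc i) u)
  rim-neighbours-adj {i} (here refl)         = adj-prevV i
  rim-neighbours-adj {i} (there (here refl)) = adj-nextV i

  rim-cover₃ : ∀ {i u} → T (adj G (suc i) u) → u ∈ centre ∷ rim-neighbours i
  rim-cover₃ {i} {zero}  _ = here refl
  rim-cover₃ {i} {suc j} t with adj⇒prevV⊎nextV {i} {j} t
  ... | inj₁ refl = there (here refl)
  ... | inj₂ refl = there (there (here refl))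

  rim-cover₂ : ∀ {i u} → ¬ Spoke (toℕ i) → T (adj G (suc i) u) → u ∈ rim-neighbours i
  rim-cover₂ {i} {zero}  ¬s t = ⊥-elim (¬s (adj˘⇒spoke {i} t))
  rim-cover₂ {i} {suc j} ¬s t with rim-cover₃ {i} {suc j} t
  ... | there u∈ = u∈

  rim-deg-≤ : ∀ i → deg G (suc i) ≤ 3
  rim-deg-≤ i = deg-≤ G {suc i} rim-cover₃

  rim-deg-≤-¬spoke : ∀ {i} → ¬ Spoke (toℕ i) → deg G (suc i) ≤ 2
  rim-deg-≤-¬spoke {i} ¬s = deg-≤ G {suc i} (rim-cover₂ ¬s)

  maxDeg≤n : maxDeg G ≤ n
  maxDeg≤n = maxDeg-≤ G λ where
    zero    → centre-deg-≤
    (suc i) → ≤-trans (rim-deg-≤ i) (s≤s (s≤s (s≤s z≤n)))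

  gear-colouring :
    ∀ {k r} c₀ {f : ℕ → ℕ} → SquareColouring ℓ f → c₀ < k → (f< : ∀ p → f p < k) →
    (∀ p → Spoke p → c₀ ≢ f p) → (3 ≤ r → ∀ p → c₀ ≢ f p) →
    (∀ {i} → i < r → f (i + i) ≡ i) → 2 ≤ r → r ≤ n → r ≤ k →
    (∀ c → c < k → c ≡ c₀ ⊎ ∃[ p ] p ≤ ℓ × f p ≡ c) → CondColouring G k r
  gear-colouring {k} {r} c₀ {f} f-sq c₀<k f< spoke-free rim-free spoke-colours 2≤r r≤n r≤k onto =
    record { r≤k = r≤k ; col = col ; surj = surj ; C1 = C1 ; C2 = C2 }
    where
    col : Fin (size G) → Fin k
    col zero    = fromℕ< c₀<k
    col (suc i) = colourFin f< (toℕ i)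

    centre≢rim : ∀ {i} → c₀ ≢ f (toℕ i) → col centre ≢ col (suc i)
    centre≢rim {i} c₀≢f e =
      c₀≢f (trans (sym (toℕ-fromℕ< c₀<k)) (trans (cong toℕ e) (toℕ-colourFin f< (toℕ i))))

    surj : ∀ c → ∃ λ v → col v ≡ c
    surj c with onto (toℕ c) (toℕ<n c)
    ... | inj₁ c≡c₀              = centre , toℕ-injective (trans (toℕ-fromℕ< c₀<k) (sym c≡c₀))
    ... | inj₂ (p , p≤ℓ , fp≡c) = rim p ,
      toℕ-injective (trans (toℕ-colourFin f< _) (trans (cong f (toℕ-vertexAt p≤ℓ)) fp≡c))

    C1 : ∀ u v → T (adj G u v) → col u ≢ col v
    C1 zero    (suc j) t = centre≢rim (spoke-free _ (adj⇒spoke {j} t))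
    C1 (suc i) zero    t = centre≢rim (spoke-free _ (adj˘⇒spoke {i} t)) ∘ sym
    C1 (suc i) (suc j) t with adj⇒prevV⊎nextV {i} {j} t
    ... | inj₁ refl = colourFin-≢ f< (a≢b (square-at f-sq i) ∘ sym)
    ... | inj₂ refl = colourFin-≢ f< (b≢c (square-at f-sq i))

    toℕ-col-spoke : ∀ (a : Fin r) → toℕ (col (spokeAt (toℕ a))) ≡ toℕ a
    toℕ-col-spoke a = begin
      toℕ (colourFin f< (toℕ (vertexAt (toℕ a + toℕ a)))) ≡⟨ toℕ-colourFin f< _ ⟩
      f (toℕ (vertexAt (toℕ a + toℕ a)))                  ≡⟨ cong f (toℕ-spokeAt (≤-trans (toℕ<n a) r≤n)) ⟩
      f (toℕ a + toℕ a)                                   ≡⟨ spoke-colours (toℕ<n a) ⟩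
      toℕ a                                               ∎
      where open ≡-Reasoning

    spoke-colours! : Unique (map col (spokes r))
    spoke-colours! = subst Unique (map-∘ (allFin r))
      (Unique.map⁺ (λ {a} {b} e →
         toℕ-injective (trans (sym (toℕ-col-spoke a)) (trans (cong toℕ e) (toℕ-col-spoke b))))
        (Unique.allFin⁺ r))

    rim-two : ∀ i → 2 ≤ numColours col (nbrs G (suc i))
    rim-two i = numColours-≥ col {S = nbrs G (suc i)} {us = rim-neighbours i}
      ((colourFin-≢ f< (a≢c (square-at f-sq i)) ∷ []) ∷ [] ∷ []) (∈-nbrs⁺ G {suc i} ∘ rim-neighbours-adj)

    rim-three : ∀ {i} → Spoke (toℕ i) → 3 ≤ r → 3 ≤ numColours col (nbrs G (suc i))
    rim-three {i} s 3≤r = numColours-≥ col {S = nbrs G (suc i)} {us = centre ∷ rim-neighbours i}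
      ((centre≢rim (rim-free 3≤r _) ∷ centre≢rim (rim-free 3≤r _) ∷ []) ∷
       (colourFin-≢ f< (a≢c (square-at f-sq i)) ∷ []) ∷ [] ∷ [])
      λ { (here refl) → ∈-nbrs⁺ G {suc i} (spoke⇒adj˘ {i} s)
        ; (there u∈)  → ∈-nbrs⁺ G {suc i} (rim-neighbours-adj u∈) }

    C2 : ∀ v → deg G v ⊓ r ≤ numColours col (nbrs G v)
    C2 zero = ≤-trans (m⊓n≤n _ r) (subst (_≤ numColours col (nbrs G centre)) (length-spokes r)
      (numColours-≥ col spoke-colours! (∈-nbrs⁺ G {centre} ∘ spokes-adj r≤n)))
    C2 (suc i) with T? (odd? (suc (toℕ i))) | 3 ≤? r
    ... | yes s  | yes 3≤r = ≤-trans (m⊓n≤m _ r) (≤-trans (rim-deg-≤ i) (rim-three {i} s 3≤r))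
    ... | _      | no  3≰r = ≤-trans (m⊓n≤n _ r) (≤-trans (s≤s⁻¹ (≰⇒> 3≰r)) (rim-two i))
    ... | no ¬s  | yes _   = ≤-trans (m⊓n≤m _ r) (≤-trans (rim-deg-≤-¬spoke {i} ¬s) (rim-two i))

  module _ {k r} (χ : CondColouring G k r) (3≤r : 3 ≤ r) where
    open CondColouring χ

    rim-rainbow : ∀ {i} → Spoke (toℕ i) → ∀ {u w} → u ∈ centre ∷ rim-neighbours i →
                  w ∈ centre ∷ rim-neighbours i → u ≢ w → col u ≢ col w
    rim-rainbow {i} s = rainbow-neighbourhood χ {suc i}
      (((λ ()) ∷ (λ ()) ∷ []) ∷ rim-neighbours! i) adjacent rim-cover₃ 3≤r
      where
      adjacent : ∀ {u} → u ∈ centre ∷ rim-neighbours i → T (adj G (suc i) u)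
      adjacent (here refl) = spoke⇒adj˘ {i} s
      adjacent (there u∈)  = rim-neighbours-adj u∈

    rim-square : SquareColouring ℓ (col ∘ rim)
    rim-square = square-of-vertices {c = col ∘ suc} λ i →
      distinct₃ (C1 (suc i) (suc (prevV i)) (adj-prevV i) ∘ sym) (ends i) (C1 (suc i) (suc (nextV i)) (adj-nextV i))
      where
      ends : ∀ i → col (suc (prevV i)) ≢ col (suc (nextV i))
      ends i with T? (odd? (suc (toℕ i)))
      ... | yes s = rim-rainbow {i} s (there (here refl)) (there (there (here refl)))
                      (prevV≢nextV i ∘ Finₚ.suc-injective)
      ... | no ¬s = rainbow-neighbourhood χ {suc i} (rim-neighbours! i) rim-neighbours-adj
                      (rim-cover₂ ¬s) (≤-trans (n≤1+n 2) 3≤r) (here refl) (there (here refl))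
                      (prevV≢nextV i ∘ Finₚ.suc-injective)

    -- A non-spoke position follows a spoke position, whose rainbow neighbourhood contains the centre.
    centre-colour-unused : ∀ {p} → p ≤ ℓ → col (rim p) ∉ col centre ∷ []
    centre-colour-unused {p} p≤ℓ (here e) with T? (odd? (suc p))
    ... | yes s = C1 centre (rim p) (spoke⇒adj {vertexAt p} (subst Spoke (sym (toℕ-vertexAt p≤ℓ)) s)) (sym e)
    centre-colour-unused {zero}  p≤ℓ (here e) | no ¬s = ¬s _
    centre-colour-unused {suc q} p≤ℓ (here e) | no ¬s =
      rim-rainbow {vertexAt q} (subst Spoke (sym (toℕ-vertexAt q≤ℓ)) (¬spoke-suc⇒spoke {q} ¬s))
        (here refl) (there (there (here refl))) (λ ()) (trans (sym e) (cong col next≡))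
      where
      q≤ℓ = <⇒≤ p≤ℓ
      next≡ : rim (suc q) ≡ suc (nextV (vertexAt q))
      next≡ = cong (λ m → suc (vertexAt m))
                (trans (sym (next-< p≤ℓ)) (cong (next ℓ) (sym (toℕ-vertexAt q≤ℓ))))

  module _ {k} (χ : CondColouring G k 2) where
    open CondColouring χ

    ¬spoke-takes-centre-colour : k ≤ 3 → ∀ {i} → ¬ Spoke (toℕ i) → col (suc i) ≡ col centre
    ¬spoke-takes-centre-colour k≤3 {i} ¬s with col (suc i) ≟ᶠ col centre
    ... | yes e = e
    ... | no  e = ⊥-elim (1+n≰n (≤-trans (unique⇒length≤ four) k≤3))
      where
      at-spoke : ∀ {j} → Spoke (toℕ j) → col centre ≢ col (suc j)
      at-spoke {j} s = C1 centre (suc j) (spoke⇒adj {j} s)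
      prev-spoke = subst Spoke (sym (toℕ-prevV i)) (¬spoke⇒prev-spoke {ℓ} {toℕ i} ¬s)
      next-spoke = subst Spoke (sym (toℕ-nextV i)) (¬spoke⇒next-spoke {ℓ} {toℕ i} ¬s)
      four : Unique (col (suc i) ∷ col centre ∷ col (suc (prevV i)) ∷ col (suc (nextV i)) ∷ [])
      four = (e ∷ C1 (suc i) _ (adj-prevV i) ∷ C1 (suc i) _ (adj-nextV i) ∷ []) ∷
             (at-spoke prev-spoke ∷ at-spoke next-spoke ∷ []) ∷
             (rainbow-neighbourhood χ {suc i} (rim-neighbours! i) rim-neighbours-adj (rim-cover₂ ¬s) ≤-refl
                (here refl) (there (here refl)) (prevV≢nextV i ∘ Finₚ.suc-injective) ∷ []) ∷ [] ∷ []

    -- Position 0 is a spoke whose two rim neighbours are non-spokes, so it would see only one colour.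
    gear-2-≥4 : 4 ≤ k
    gear-2-≥4 with 4 ≤? k
    ... | yes 4≤k = 4≤k
    ... | no  4≰k = ⊥-elim (1+n≰n (begin
      2                               ≤⟨ ⊓-glb (deg-≥ G {rim 0} (rim-neighbours! zero) rim-neighbours-adj) ≤-refl ⟩
      deg G (rim 0) ⊓ 2               ≤⟨ C2 (rim 0) ⟩
      numColours col (nbrs G (rim 0)) ≤⟨ numColours-≤ col monochrome ⟩
      1                               ∎))
      where
      open ≤-Reasoning
      k≤3 = s≤s⁻¹ (≰⇒> 4≰k)
      ¬spoke-prev : ¬ Spoke (toℕ (prevV zero))
      ¬spoke-prev = subst (¬_ ∘ Spoke) (sym (toℕ-prevV zero)) ¬spoke-ℓ
      ¬spoke-next : ¬ Spoke (toℕ (nextV zero))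
      ¬spoke-next = subst (¬_ ∘ Spoke) (sym (trans (toℕ-nextV zero) (next-< {ℓ} (s≤s z≤n)))) (λ ())
      monochrome : ∀ {u} → u ∈ nbrs G (rim 0) → col u ∈ col centre ∷ []
      monochrome {u} u∈ with rim-cover₃ {zero} {u} (∈-nbrs⁻ G {rim 0} u∈)
      ... | here refl                 = here refl
      ... | there (here refl)         = here (¬spoke-takes-centre-colour k≤3 ¬spoke-prev)
      ... | there (there (here refl)) = here (¬spoke-takes-centre-colour k≤3 ¬spoke-next)

  fresh-centre-colouring : ∀ {K r} {f : ℕ → ℕ} → SquareColouring ℓ f → (∀ p → f p < K) →
    (∀ {i} → i < K → f (i + i) ≡ i) → K ≤ n → 2 ≤ r → r ≤ K → CondColouring G (suc K) r
  fresh-centre-colouring {K} {r} {f} f-sq f<K f-spokes K≤n 2≤r r≤K =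
    gear-colouring K f-sq ≤-refl (λ p → ≤-trans (f<K p) (n≤1+n K)) (λ p _ → fresh p) (λ _ → fresh)
      (λ i<r → f-spokes (≤-trans i<r r≤K)) 2≤r (≤-trans r≤K K≤n) (≤-trans r≤K (n≤1+n K)) onto
    where
    fresh : ∀ p → K ≢ f p
    fresh p e = <-irrefl (sym e) (f<K p)
    onto : ∀ c → c < suc K → c ≡ K ⊎ ∃[ p ] p ≤ ℓ × f p ≡ c
    onto c c≤K with c ≟ K
    ... | yes c≡K = inj₁ c≡K
    ... | no  c≢K = inj₂ (c + c , double≤ℓ (≤-trans c<K K≤n) , f-spokes c<K)
      where c<K = ≤∧≢⇒< (s≤s⁻¹ c≤K) c≢K

  centre-3-colouring : ∀ {f} → SquareColouring ℓ f → (∀ p → f p < 4) → (∀ p → Spoke p → 3 ≢ f p) →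
                       f 0 ≡ 0 → f 2 ≡ 1 → f 3 ≡ 2 → CondColouring G 4 2
  centre-3-colouring {f} f-sq f<4 spoke-free f0 f2 f3 =
    gear-colouring 3 f-sq ≤-refl f<4 spoke-free (λ { (s≤s (s≤s ())) }) spoke-colours
      ≤-refl (s≤s (s≤s z≤n)) (s≤s (s≤s z≤n)) onto
    where
    3≤ℓ : 3 ≤ ℓ
    3≤ℓ = s≤s (s≤s (≤-trans (s≤s z≤n) (m≤n+m n n′)))
    spoke-colours : ∀ {i} → i < 2 → f (i + i) ≡ i
    spoke-colours {0} _ = f0
    spoke-colours {1} _ = f2
    spoke-colours {suc (suc _)} (s≤s (s≤s ()))
    onto : ∀ c → c < 4 → c ≡ 3 ⊎ ∃[ p ] p ≤ ℓ × f p ≡ c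
    onto 0 _ = inj₂ (0 , z≤n , f0)
    onto 1 _ = inj₂ (2 , ≤-trans (n≤1+n 2) 3≤ℓ , f2)
    onto 2 _ = inj₂ (3 , 3≤ℓ , f3)
    onto 3 _ = inj₁ refl
    onto (suc (suc (suc (suc _)))) (s≤s (s≤s (s≤s (s≤s ()))))

  -- Everything that depends on n mod 3: m = χ₂(C_2n), a square colouring of the rim with m
  -- colours in which spoke i has colour i, the matching lower bound, and a (4,2)-colouring of G_n.
  record ResidueClass : Set where
    field
      m            : ℕ
      3≤m          : 3 ≤ m
      m≤4          : m ≤ 4
      m≤n          : m ≤ n
      base         : ℕ → ℕ
      base-square  : SquareColouring ℓ base
      base-<       : ∀ p → base p < m
      base-spokes  : ∀ {i} → i < m → base (i + i) ≡ i
      square-lower : ∀ {k} {F : ℕ → Fin k} {xs} → SquareColouring ℓ F → Unique xs →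
                     (∀ {p} → p ≤ ℓ → F p ∉ xs) → m + length xs ≤ k
      colouring₂   : CondColouring G 4 2

  module _ (D : ResidueClass) where
    open ResidueClass D

    χ₂-gear : IsCondChrom 2 G 4
    χ₂-gear = colouring₂ , λ _ χ → gear-2-≥4 χ

    χ₂-cycle : IsCondChrom 2 C m
    χ₂-cycle = cycle-colouring base-square base-< onto (≤-trans (n≤1+n 2) 3≤m) ,
               λ k χ → subst (_≤ k) (+-identityʳ m) (square-lower (cycle-square χ) [] λ _ ())
      where
      onto : ∀ c → c < m → ∃[ p ] p ≤ ℓ × base p ≡ c
      onto c c<m = c + c , double≤ℓ (≤-trans c<m m≤n) , base-spokes c<m

    χ₃-gear : IsCondChrom 3 G (suc m)
    χ₃-gear = fresh-centre-colouring base-square base-< base-spokes m≤n (n≤1+n 2) 3≤m ,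
              λ k χ → subst (_≤ k) (+-comm m 1)
                        (square-lower (rim-square χ ≤-refl) ([] ∷ []) (centre-colour-unused χ ≤-refl))

    χ-large : ∀ r → 4 ≤ r → r ≤ maxDeg G → IsCondChrom r G (suc (r ⊓ maxDeg G))
    χ-large r 4≤r r≤Δ rewrite m≤n⇒m⊓n≡m r≤Δ =
      fresh-centre-colouring (recolour-square base-< m≤r (s≤s (s≤s z≤n)) base-square) (recolour-< base-< m≤r)
        (recolour-spokes base-< m≤r base-spokes) r≤n (≤-trans (n≤1+n 2) (≤-trans (n≤1+n 3) 4≤r)) ≤-refl ,
      λ k χ → subst (λ d → suc d ≤ k) (m≥n⇒m⊓n≡n (≤-trans r≤n centre-deg-≥))
                (closedNeighbourhood-bound χ centre)
      where
      r≤n = ≤-trans r≤Δ maxDeg≤n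
      m≤r = ≤-trans m≤4 4≤r

    chromatic-numbers : IsCondChrom 2 (gear n) 4
      × Σ ℕ (λ m → IsCondChrom 2 (cycle (n + n)) m × IsCondChrom 3 (gear n) (suc m))
      × ((r : ℕ) → 4 ≤ r → r ≤ maxDeg (gear n) → IsCondChrom r (gear n) (suc (r ⊓ maxDeg (gear n))))
    chromatic-numbers = χ₂-gear , (m , χ₂-cycle , χ₃-gear) , χ-large

-- Periodic rim patterns

periodic3 : ℕ → ℕ → ℕ → ℕ → ℕ
periodic3 x y z zero                = x
periodic3 x y z (suc zero)          = y
periodic3 x y z (suc (suc zero))    = z
periodic3 x y z (suc (suc (suc p))) = periodic3 x y z p

prepend : List ℕ → (ℕ → ℕ) → ℕ → ℕ
prepend []       g p       = g p
prepend (d ∷ ds) g zero    = d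
prepend (d ∷ ds) g (suc p) = prepend ds g p

-- The colour sequence  prefix, x, y, z, x, y, z, …
record RimPattern : Set where
  constructor rimPattern
  field
    prefix : List ℕ
    x y z  : ℕ

colour : RimPattern → ℕ → ℕ
colour (rimPattern ds x y z) = prepend ds (periodic3 x y z)

palette : RimPattern → List ℕ
palette (rimPattern ds x y z) = x ∷ y ∷ z ∷ ds

Triples : (ℕ → ℕ) → Set
Triples f = ∀ p → Distinct₃ (f p) (f (suc p)) (f (suc (suc p)))

PrefixTriples : List ℕ → (ℕ → ℕ) → Set
PrefixTriples []       g = ⊤
PrefixTriples (d ∷ ds) g = Distinct₃ d (prepend ds g 0) (prepend ds g 1) × PrefixTriples ds g

-- Every cycle of length |prefix| + 3j + 2, which ends in x, y, is then square coloured.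
ValidPattern : RimPattern → Set
ValidPattern P@(rimPattern ds x y z) =
  Distinct₃ x y z × PrefixTriples ds (periodic3 x y z) ×
  Distinct₃ x y (colour P 0) × Distinct₃ y (colour P 0) (colour P 1)

distinct₃? : (a b c : ℕ) → Dec (Distinct₃ a b c)
distinct₃? a b c = map′ (λ (ab , ac , bc) → distinct₃ ab ac bc) (λ (distinct₃ ab ac bc) → ab , ac , bc)
  (¬? (a ≟ b) ×-dec ¬? (a ≟ c) ×-dec ¬? (b ≟ c))

prefixTriples? : ∀ ds g → Dec (PrefixTriples ds g)
prefixTriples? []       g = yes tt
prefixTriples? (d ∷ ds) g = distinct₃? d (prepend ds g 0) (prepend ds g 1) ×-dec prefixTriples? ds g

validPattern? : ∀ P → Dec (ValidPattern P)
validPattern? P@(rimPattern ds x y z) =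
  distinct₃? x y z ×-dec prefixTriples? ds (periodic3 x y z) ×-dec
  distinct₃? x y (colour P 0) ×-dec distinct₃? y (colour P 0) (colour P 1)

periodic3-triples : ∀ {x y z} → Distinct₃ x y z → Triples (periodic3 x y z)
periodic3-triples xyz zero                = xyz
periodic3-triples xyz (suc zero)          = distinct₃ (b≢c xyz) (a≢b xyz ∘ sym) (a≢c xyz ∘ sym)
periodic3-triples xyz (suc (suc zero))    = distinct₃ (a≢c xyz ∘ sym) (b≢c xyz ∘ sym) (a≢b xyz)
periodic3-triples xyz (suc (suc (suc p))) = periodic3-triples xyz p

prepend-triples : ∀ ds {g} → PrefixTriples ds g → Triples g → Triples (prepend ds g)
prepend-triples []       _              g-tr         = g-tr
prepend-triples (d ∷ ds) (d-tr , _)     g-tr zero    = d-tr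
prepend-triples (d ∷ ds) (_    , ds-tr) g-tr (suc p) = prepend-triples ds ds-tr g-tr p

prepend-length : ∀ ds g q → prepend ds g (length ds + q) ≡ g q
prepend-length []       g q = refl
prepend-length (d ∷ ds) g q = prepend-length ds g q

periodic3-period : ∀ x y z j i → periodic3 x y z (j * 3 + i) ≡ periodic3 x y z i
periodic3-period x y z zero    i = refl
periodic3-period x y z (suc j) i = periodic3-period x y z j i

periodic3-< : ∀ {k x y z} → x < k → y < k → z < k → ∀ p → periodic3 x y z p < k
periodic3-< x< y< z< zero                = x<
periodic3-< x< y< z< (suc zero)          = y<
periodic3-< x< y< z< (suc (suc zero))    = z<
periodic3-< x< y< z< (suc (suc (suc p))) = periodic3-< x< y< z< p

colour-< : ∀ {k} P → All (_< k) (palette P) → ∀ p → colour P p < k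
colour-< (rimPattern ds x y z) (x< ∷ y< ∷ z< ∷ ds<) = go ds ds<
  where
  go : ∀ ds → All (_< _) ds → ∀ p → prepend ds (periodic3 x y z) p < _
  go []       []         p       = periodic3-< x< y< z< p
  go (d ∷ ds) (d< ∷ _)   zero    = d<
  go (d ∷ ds) (_  ∷ ds<) (suc p) = go ds ds< p

module _ (P : RimPattern) (j : ℕ) where
  open RimPattern P

  colour-wrap-x : colour P (length prefix + j * 3) ≡ x
  colour-wrap-x = begin
    colour P (length prefix + j * 3)  ≡⟨ prepend-length prefix _ (j * 3) ⟩
    periodic3 x y z (j * 3)           ≡⟨ cong (periodic3 x y z) (+-identityʳ (j * 3)) ⟨
    periodic3 x y z (j * 3 + 0)       ≡⟨ periodic3-period x y z j 0 ⟩
    x                                 ∎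
    where open ≡-Reasoning

  colour-wrap-y : colour P (suc (length prefix + j * 3)) ≡ y
  colour-wrap-y = begin
    colour P (suc (length prefix + j * 3))  ≡⟨ cong (colour P) (+-suc (length prefix) (j * 3)) ⟨
    colour P (length prefix + suc (j * 3))  ≡⟨ prepend-length prefix _ (suc (j * 3)) ⟩
    periodic3 x y z (suc (j * 3))           ≡⟨ cong (periodic3 x y z) (+-comm 1 (j * 3)) ⟩
    periodic3 x y z (j * 3 + 1)             ≡⟨ periodic3-period x y z j 1 ⟩
    y                                       ∎
    where open ≡-Reasoning

  pattern-square : ∀ {ℓ} → ℓ ≡ suc (length prefix + j * 3) → ValidPattern P → SquareColouring ℓ (colour P)
  pattern-square refl (xyz , prefix-tr , wrap-x , wrap-y) {zero} _
    rewrite next-< {suc (length prefix + j * 3)} (s≤s z≤n) | colour-wrap-y = wrap-y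
  pattern-square refl (xyz , prefix-tr , wrap-x , wrap-y) {suc p} p<ℓ
    with suc p ≟ suc (length prefix + j * 3)
  ... | yes refl rewrite colour-wrap-x | colour-wrap-y = wrap-x
  ... | no _     = prepend-triples prefix prefix-tr (periodic3-triples xyz) p

-- The three residue classes of n modulo 3

-- For n = 3 + n′ with n′ = c + 3b, the last rim position ℓ = 2n − 1 equals 5 + 2c + 3(b + b).
rim-length : ∀ c b → (c + b * 3) + (3 + (c + b * 3)) ≡ 3 + (c + c) + (b + b) * 3
rim-length = solve-∀

-- Optimal square colourings of C_2n for n ≡ 0, 1, 2 (mod 3); spoke i has colour i for i < m.
square₀ square₁ square₂ : RimPattern
square₀ = rimPattern (0 ∷ []) 2 1 0
square₁ = rimPattern (0 ∷ 3 ∷ 1 ∷ 0 ∷ 2 ∷ 1 ∷ []) 3 2 0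
square₂ = rimPattern (0 ∷ 2 ∷ []) 1 3 2

-- Square colourings of C_2n for n ≡ 1, 2 (mod 3) that keep colour 3 off the spokes.
threeFree₁ threeFree₂ : RimPattern
threeFree₁ = rimPattern (0 ∷ 3 ∷ 1 ∷ 2 ∷ 0 ∷ 3 ∷ []) 1 2 0
threeFree₂ = rimPattern (0 ∷ 3 ∷ []) 1 2 0

tail₁₂₀-≢3 : ∀ p → 3 ≢ periodic3 1 2 0 p
tail₁₂₀-≢3 p e =
  <-irrefl (sym e) (periodic3-< (s≤s (s≤s z≤n)) (s≤s (s≤s (s≤s z≤n))) (s≤s z≤n) p)

threeFree₁-spoke-free : ∀ p → Spoke p → 3 ≢ colour threeFree₁ p
threeFree₁-spoke-free 0 _ ()
threeFree₁-spoke-free 1 ()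
threeFree₁-spoke-free 2 _ ()
threeFree₁-spoke-free 3 ()
threeFree₁-spoke-free 4 _ ()
threeFree₁-spoke-free 5 ()
threeFree₁-spoke-free (suc (suc (suc (suc (suc (suc p)))))) _ = tail₁₂₀-≢3 p

threeFree₂-spoke-free : ∀ p → Spoke p → 3 ≢ colour threeFree₂ p
threeFree₂-spoke-free 0 _ ()
threeFree₂-spoke-free 1 ()
threeFree₂-spoke-free (suc (suc p)) _ = tail₁₂₀-≢3 p

class₀ : ∀ b → Gear.ResidueClass (b * 3)
class₀ b = record
  { m = 3 ; 3≤m = ≤-refl ; m≤4 = n≤1+n 3 ; m≤n = s≤s (s≤s (s≤s z≤n))
  ; base = colour square₀ ; base-square = square ; base-< = bounded ; base-spokes = spoke-colours
  ; square-lower = λ F-sq → square-≥3 F-sq (s≤s (s≤s z≤n))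
  ; colouring₂ = fresh-centre-colouring square bounded spoke-colours (s≤s (s≤s (s≤s z≤n))) ≤-refl (n≤1+n 2)
  }
  where
  open Gear (b * 3)
  square : SquareColouring ℓ (colour square₀)
  square = pattern-square square₀ (1 + (b + b)) (cong (λ x → suc (suc x)) (rim-length 0 b))
             (from-yes (validPattern? square₀))
  bounded : ∀ p → colour square₀ p < 3
  bounded = colour-< square₀ (from-yes (all? (_<? 3) (palette square₀)))
  spoke-colours : ∀ {i} → i < 3 → colour square₀ (i + i) ≡ i
  spoke-colours {0} _ = refl
  spoke-colours {1} _ = refl
  spoke-colours {2} _ = refl
  spoke-colours {suc (suc (suc _))} (s≤s (s≤s (s≤s ())))

class₁ : ∀ b → Gear.ResidueClass (1 + b * 3)
class₁ b = record
  { m = 4 ; 3≤m = n≤1+n 3 ; m≤4 = ≤-refl ; m≤n = s≤s (s≤s (s≤s (s≤s z≤n)))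
  ; base = colour square₁
  ; base-square = pattern-square square₁ (b + b) ℓ≡ (from-yes (validPattern? square₁))
  ; base-< = colour-< square₁ (from-yes (all? (_<? 4) (palette square₁)))
  ; base-spokes = spoke-colours
  ; square-lower = λ F-sq → square-≥4 F-sq (2 + (b + b)) (inj₂ ℓ≡) (s≤s (s≤s z≤n))
  ; colouring₂ = centre-3-colouring (pattern-square threeFree₁ (b + b) ℓ≡ (from-yes (validPattern? threeFree₁)))
      (colour-< threeFree₁ (from-yes (all? (_<? 4) (palette threeFree₁)))) threeFree₁-spoke-free refl refl refl
  }
  where
  open Gear (1 + b * 3)
  ℓ≡ : ℓ ≡ suc (6 + (b + b) * 3)
  ℓ≡ = cong (λ x → suc (suc x)) (rim-length 1 b)
  spoke-colours : ∀ {i} → i < 4 → colour square₁ (i + i) ≡ i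
  spoke-colours {0} _ = refl
  spoke-colours {1} _ = refl
  spoke-colours {2} _ = refl
  spoke-colours {3} _ = refl
  spoke-colours {suc (suc (suc (suc _)))} (s≤s (s≤s (s≤s (s≤s ()))))

class₂ : ∀ b → Gear.ResidueClass (2 + b * 3)
class₂ b = record
  { m = 4 ; 3≤m = n≤1+n 3 ; m≤4 = ≤-refl ; m≤n = s≤s (s≤s (s≤s (s≤s z≤n)))
  ; base = colour square₂
  ; base-square = pattern-square square₂ (2 + (b + b)) ℓ≡ (from-yes (validPattern? square₂))
  ; base-< = colour-< square₂ (from-yes (all? (_<? 4) (palette square₂)))
  ; base-spokes = spoke-colours
  ; square-lower = λ F-sq → square-≥4 F-sq (3 + (b + b)) (inj₁ ℓ≡) (s≤s (s≤s z≤n))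
  ; colouring₂ = centre-3-colouring (pattern-square threeFree₂ (2 + (b + b)) ℓ≡ (from-yes (validPattern? threeFree₂)))
      (colour-< threeFree₂ (from-yes (all? (_<? 4) (palette threeFree₂)))) threeFree₂-spoke-free refl refl refl
  }
  where
  open Gear (2 + b * 3)
  ℓ≡ : ℓ ≡ suc (2 + (2 + (b + b)) * 3)
  ℓ≡ = cong (λ x → suc (suc x)) (rim-length 2 b)
  spoke-colours : ∀ {i} → i < 4 → colour square₂ (i + i) ≡ i
  spoke-colours {0} _ = refl
  spoke-colours {1} _ = refl
  spoke-colours {2} _ = refl
  spoke-colours {3} _ = refl
  spoke-colours {suc (suc (suc (suc _)))} (s≤s (s≤s (s≤s (s≤s ()))))

data Residue3 : ℕ → Set where
  res₀ : ∀ b → Residue3 (b * 3)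
  res₁ : ∀ b → Residue3 (1 + b * 3)
  res₂ : ∀ b → Residue3 (2 + b * 3)

residue3 : ∀ n → Residue3 n
residue3 zero                = res₀ 0
residue3 (suc zero)          = res₁ 0
residue3 (suc (suc zero))    = res₂ 0
residue3 (suc (suc (suc n))) with residue3 n
... | res₀ b = res₀ (suc b)
... | res₁ b = res₁ (suc b)
... | res₂ b = res₂ (suc b)

proposition3p10 : (n : ℕ) → 3 ≤ n →
    IsCondChrom 2 (gear n) 4
    × Σ ℕ (λ m → IsCondChrom 2 (cycle (n + n)) m × IsCondChrom 3 (gear n) (suc m))
    × ((r : ℕ) → 4 ≤ r → r ≤ maxDeg (gear n) →
    IsCondChrom r (gear n) (suc (r ⊓ maxDeg (gear n))))
proposition3p10 (suc zero)           (s≤s ())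
proposition3p10 (suc (suc zero))     (s≤s (s≤s ()))
proposition3p10 (suc (suc (suc n′))) _ with residue3 n′
... | res₀ b = Gear.chromatic-numbers (b * 3) (class₀ b)
... | res₁ b = Gear.chromatic-numbers (1 + b * 3) (class₁ b)
... | res₂ b = Gear.chromatic-numbers (2 + b * 3) (class₂ b)
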